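{- Let $0\le a,b,c,h\le n$ with $a+b+c=n$. If $c\le n-h$, $a\ge1$ and $(a-1,b+1,c)\ne(0,h,n-h)$, then $$D_{n,h}(a,b,c)-D_{n,h}(a-1,b+1,c)=-(-q)^{2n-h-1-b-2c}D_{n-1,h-1}(a-1,b,c).$$
   Context: $q$ is a power of an odd prime. Put $P(k)=\prod_{l=1}^{k}(1-(-q)^{ -l})$ (empty products $=1$, empty sums $=0$). For nonnegative integers $a,b,c$ and integer $j$: if $a+b>0$, $\mathcal C_j(a,b,c)=(-1)^{j+1}\prod_{i=1}^{a+b-1}(1-(-q)^i)$; and $\mathcal C_j(0,0,c)=\sum_{l=1}^{c}\frac1{(-q)^l-1}$. Let $M_{n,h}(a,b,c,i,s)=(-q)^{n(h-i)+\frac{(i-s)(2n-i+s+1)}{2}-h^2+s(2n-2c-s)}(-1)^{i+h}\frac{P(n-i)}{P(n-h)P(h)}\cdot\frac{\prod_{l=s+1}^{h}(1-(-q)^{ -l})}{P(h-i)P(i-s)}\cdot\frac{P(c)P(b)}{P(c-i+s)P(b-s)}\cdot\mathcal C_{h+1-s}(a,b-s,c+s-i)$. For nonnegative $a,b,c$ with $a+b+c=n$, define $D_{n,h}(a,b,c)=\sum_{0\le s\le\min(h,b)}\sum_{s\le i\le\min(s+c,h)}M_{n,h}(a,b,c,i,s)$ when $(a,b,c)\ne(0,t,n-t)$ with $t\le h-1$; and for $(a,b,c)=(0,t,n-t)$ with $t\le h-1$, $t\equiv h+1\pmod 2$, define $D_{n,h}(0,t,n-t)$ as the same double sum plus $\frac{(-q)^{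 -(h-t)(h+t+1)/2}}{1-(-q)^{ -(h-t)}}$. (When $h-1<0$, the double sum defining $D_{n-1,h-1}$ is empty, hence $0$.) -}

module Defs where

open import Data.Nat as ℕ using (ℕ; zero; suc; _∸_; _≤ᵇ_)
open import Data.Nat.Primality using (Prime)
open import Data.Integer as ℤ using (ℤ; +_; -[1+_])
open import Data.Integer.DivMod using (_/ℕ_)
open import Data.Rational as ℚ using (ℚ; 0ℚ; 1ℚ; _+_; _*_; _-_; -_; 1/_; ≢-nonZero)
open import Data.Rational.Properties using (_≟_)
open import Data.List using (List; foldr; map; upTo)
open import Data.Bool using (Bool; true; false; if_then_else_; _∧_)
open import Relation.Nullary using (yes; no)
open import Data.Product using (Σ; _×_)
open import Relation.Binary.PropositionalEquality using (_≡_)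

qℚ : ℕ → ℚ
qℚ q = (+ q) ℚ./ 1

mq : ℕ → ℚ
mq q = - qℚ q

_^ℕ_ : ℚ → ℕ → ℚ
x ^ℕ zero = 1ℚ
x ^ℕ suc n = x * (x ^ℕ n)

-- total inverse (1/x for x ≠ 0, and 0 for x = 0); it is only ever applied
-- to nonzero values in the formulas below (q ≥ 3)
inv : ℚ → ℚ
inv x with x ≟ 0ℚ
... | yes _ = 0ℚ
... | no x≢0 = 1/_ x {{≢-nonZero x≢0}}

_^ℤ_ : ℚ → ℤ → ℚ
x ^ℤ (+ n) = x ^ℕ n
x ^ℤ -[1+ n ] = inv (x ^ℕ suc n)

mqpow : ℕ → ℤ → ℚ
mqpow q z = mq q ^ℤ z

-- Σ_{k=lo}^{hi} f k  (empty, i.e. 0, if hi < lo)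
sumFT : ℕ → ℕ → (ℕ → ℚ) → ℚ
sumFT lo hi f = foldr (λ k acc → f (lo ℕ.+ k) + acc) 0ℚ (upTo (suc hi ∸ lo))

-- Π_{k=lo}^{hi} f k  (empty, i.e. 1, if hi < lo)
prodFT : ℕ → ℕ → (ℕ → ℚ) → ℚ
prodFT lo hi f = foldr (λ k acc → f (lo ℕ.+ k) * acc) 1ℚ (upTo (suc hi ∸ lo))

sgn : ℕ → ℚ
sgn m = (- 1ℚ) ^ℕ m

P : ℕ → ℕ → ℚ
P q k = prodFT 1 k (λ l → 1ℚ - mqpow q (ℤ.- (+ l)))

𝒞 : ℕ → ℕ → ℕ → ℕ → ℕ → ℚ
𝒞 q j zero zero c = sumFT 1 c (λ l → inv (mqpow q (+ l) - 1ℚ))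
𝒞 q j a b c = sgn (suc j) * prodFT 1 (a ℕ.+ b ∸ 1) (λ i → 1ℚ - mqpow q (+ i))

-- M_{n,h}(a,b,c,i,s); only used for s ≤ b, s ≤ i ≤ s + c, i ≤ h ≤ n,
-- where all the natural-number subtractions below are genuine.
M : ℕ → ℕ → ℕ → ℕ → ℕ → ℕ → ℕ → ℕ → ℚ
M q n h a b c i s =
  mqpow q expo
  * sgn (i ℕ.+ h)
  * (P q (n ∸ i) * inv (P q (n ∸ h) * P q h))
  * (prodFT (suc s) h (λ l → 1ℚ - mqpow q (ℤ.- (+ l))) * inv (P q (h ∸ i) * P q (i ∸ s)))
  * (P q c * P q b * inv (P q (c ℕ.+ s ∸ i) * P q (b ∸ s)))
  * 𝒞 q (h ℕ.+ 1 ∸ s) a (b ∸ s) (c ℕ.+ s ∸ i)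
  where
  N H I S C : ℤ
  N = + n
  H = + h
  I = + i
  S = + s
  C = + c
  -- (i-s)(2n-i+s+1) is always even; /ℕ 2 is exact division here
  expo : ℤ
  expo = N ℤ.* (H ℤ.- I)
         ℤ.+ (((I ℤ.- S) ℤ.* (+ 2 ℤ.* N ℤ.- I ℤ.+ S ℤ.+ + 1)) /ℕ 2)
         ℤ.- H ℤ.* H
         ℤ.+ S ℤ.* (+ 2 ℤ.* N ℤ.- + 2 ℤ.* C ℤ.- S)

DSum : ℕ → ℕ → ℕ → ℕ → ℕ → ℕ → ℚ
DSum q n h a b c =
  sumFT 0 (ℕ._⊓_ h b) (λ s → sumFT s (ℕ._⊓_ (s ℕ.+ c) h) (λ i → M q n h a b c i s))

-- does (a,b,c) = (0,t,n-t) with t ≤ h-1 and t ≡ h+1 (mod 2), where t = b?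
-- (for a = 0 and a+b+c = n, automatically c = n - b)
special : ℕ → ℕ → ℕ → Bool
special h zero b = (suc b ≤ᵇ h) ∧ ((h ∸ b) ℕ.% 2 ℕ.≡ᵇ 1)
special h (suc a) b = false

-- D_{n,h}(a,b,c), for a + b + c = n.
-- (In the excluded case a = 0, b ≤ h-1, b ≡ h (mod 2), where the paper leaves D
-- undefined, this returns the plain double sum; that case never occurs in theorem9p4.)
D : ℕ → ℕ → ℕ → ℕ → ℕ → ℕ → ℚ
D q n h a b c =
  if special h a b
  then DSum q n h a b c
       + mqpow q (ℤ.- (((+ h ℤ.- + b) ℤ.* (+ h ℤ.+ + b ℤ.+ + 1)) /ℕ 2))
         * inv (1ℚ - mqpow q (ℤ.- (+ h ℤ.- + b)))
  else DSum q n h a b c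

-- D_{n-1,h-1}(a,b,c) with the convention that it is 0 when h - 1 < 0
Dprev : ℕ → ℕ → ℕ → ℕ → ℕ → ℕ → ℚ
Dprev q n zero a b c = 0ℚ
Dprev q n (suc h) a b c = D q (n ∸ 1) h a b c

OddPrimePower : ℕ → Set
OddPrimePower q = Σ ℕ (λ p → Σ ℕ (λ k →
  Prime p × (p ℕ.% 2 ≡ 1) × (1 ℕ.≤ k) × (q ≡ p ℕ.^ k)))

{-# OPTIONS --safe #-}

-- Write each double sum as a sum of rows R_s = Σ_i M(i,s).  In D_{n,h}(a,b,c) - D_{n,h}(a-1,b+1,c)
-- the rows s = 0 cancel, since there M sees (a,b) only through a + b.  The remaining terms,
-- indexed by (i+1,s+1), differ only in the ratios P(b)/P(b-s-1) and P(b+1)/P(b-s): they are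
-- T (1 - (-q)^-(b-s)) and T (1 - (-q)^-(b+1)) for a common T, with difference
-- -T (-q)^-(b-s) (1 - (-q)^-(s+1)).  Lowering n, h, i, s by one, T (-q)^-(b-s) (1 - (-q)^-(s+1))
-- is (-q)^(2n-h-1-b-2c) times the term M(i,s) of D_{n-1,h-1}(a-1,b,c): the gained factor
-- 1 - (-q)^-(s+1) and the lost factor 1 - (-q)^-h are the end factors of Π_{l=s+1}^{h} and P(h).
-- The unpaired row s = b of the second sum is the case (-q)^0 = 1 of the same identity, and the
-- special term of D obeys the same recursion under the same parity condition.

module Submission where

module _ where

  open import Data.Bool.Base using (Bool; true; false; if_then_else_)
  open import Data.Integer.Base as ℤ using (ℤ; +_; -[1+_]; _⊖_; _/ℕ_)
  import Data.Integer.Properties as ℤ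
  import Data.Integer.Tactic.RingSolver as ℤ
  open import Data.List.Base using (foldr; applyUpTo)
  open import Data.Nat.Base as ℕ using (ℕ; zero; suc; _∸_; _⊓_)
  import Data.Nat.Coprimality as Coprime
  open import Data.Nat.Divisibility using (∣-refl)
  open import Data.Nat.DivMod using (+-distrib-/-∣ˡ; +-distrib-/-∣ʳ)
  open import Data.Nat.Primality using (prime⇒nonTrivial; prime⇒nonZero)
  import Data.Nat.Properties as ℕ
  open import Data.Product.Base using (_,_)
  open import Data.Rational.Base as ℚ using (ℚ; 0ℚ; 1ℚ; _+_; _*_; _-_; -_; ∣_∣; _<_; _≤_)
  import Data.Rational.Properties as ℚ
  open import Data.Sum.Base using ([_,_]′)
  open import Level using (0ℓ)
  open import Relation.Binary.PropositionalEquality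
  open import Relation.Nullary.Decidable.Core using (yes; no; dec⇒maybe)
  open import Relation.Nullary.Negation.Core using (contradiction)
  open import Tactic.RingSolver using (solve-∀)
  open import Tactic.RingSolver.Core.AlmostCommutativeRing using (AlmostCommutativeRing; fromCommutativeRing)
  open ≡-Reasoning

  open import Defs

  ℚ-ring : AlmostCommutativeRing 0ℓ 0ℓ
  ℚ-ring = fromCommutativeRing ℚ.+-*-commutativeRing (λ x → dec⇒maybe (0ℚ ℚ.≟ x))

  -- Inverses and powers in ℚ

  inv-inverseʳ : ∀ {x} → x ≢ 0ℚ → x * inv x ≡ 1ℚ
  inv-inverseʳ {x} x≢0 with x ℚ.≟ 0ℚ
  ... | yes x≡0 = contradiction x≡0 x≢0
  ... | no  x≢0 = ℚ.*-inverseʳ x {{ℚ.≢-nonZero x≢0}}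

  *-≢0 : ∀ {x y} → x ≢ 0ℚ → y ≢ 0ℚ → x * y ≢ 0ℚ
  *-≢0 {x} {y} x≢0 y≢0 xy≡0 = x≢0 (begin
    x               ≡⟨ sym (ℚ.*-identityʳ x) ⟩
    x * 1ℚ          ≡⟨ cong (x *_) (sym (inv-inverseʳ y≢0)) ⟩
    x * (y * inv y) ≡⟨ sym (ℚ.*-assoc x y (inv y)) ⟩
    x * y * inv y   ≡⟨ cong (_* inv y) xy≡0 ⟩
    0ℚ * inv y      ≡⟨ ℚ.*-zeroˡ (inv y) ⟩
    0ℚ              ∎)

  inv-unique : ∀ {x y} → x ≢ 0ℚ → x * y ≡ 1ℚ → inv x ≡ y
  inv-unique {x} {y} x≢0 xy≡1 = begin
    inv x             ≡⟨ sym (ℚ.*-identityʳ (inv x)) ⟩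
    inv x * 1ℚ        ≡⟨ cong (inv x *_) (sym xy≡1) ⟩
    inv x * (x * y)   ≡⟨ sym (ℚ.*-assoc (inv x) x y) ⟩
    inv x * x * y     ≡⟨ cong (_* y) (trans (ℚ.*-comm (inv x) x) (inv-inverseʳ x≢0)) ⟩
    1ℚ * y            ≡⟨ ℚ.*-identityˡ y ⟩
    y                 ∎

  inv-distrib-* : ∀ x y → inv (x * y) ≡ inv x * inv y
  -- Testing 0ℚ ≟ x rather than x ≟ 0ℚ keeps `with` from abstracting the test inside inv x.
  inv-distrib-* x y with 0ℚ ℚ.≟ x | 0ℚ ℚ.≟ y
  ... | yes refl | _        = trans (cong inv (ℚ.*-zeroˡ y)) (sym (ℚ.*-zeroˡ (inv y)))
  ... | no _     | yes refl = trans (cong inv (ℚ.*-zeroʳ x)) (sym (ℚ.*-zeroʳ (inv x)))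
  ... | no 0≢x   | no 0≢y   = inv-unique (*-≢0 x≢0 y≢0) (begin
    x * y * (inv x * inv y)   ≡⟨ interchange x y (inv x) (inv y) ⟩
    x * inv x * (y * inv y)   ≡⟨ cong₂ _*_ (inv-inverseʳ x≢0) (inv-inverseʳ y≢0) ⟩
    1ℚ                        ∎)
    where
    x≢0 = ≢-sym 0≢x
    y≢0 = ≢-sym 0≢y
    interchange : ∀ a b c d → a * b * (c * d) ≡ a * c * (b * d)
    interchange = solve-∀ ℚ-ring

  inv-*-cancelʳ : ∀ x {y} → y ≢ 0ℚ → inv (x * y) * y ≡ inv x
  inv-*-cancelʳ x {y} y≢0 = begin
    inv (x * y) * y        ≡⟨ cong (_* y) (inv-distrib-* x y) ⟩
    inv x * inv y * y      ≡⟨ ℚ.*-assoc (inv x) (inv y) y ⟩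
    inv x * (inv y * y)    ≡⟨ cong (inv x *_) (trans (ℚ.*-comm (inv y) y) (inv-inverseʳ y≢0)) ⟩
    inv x * 1ℚ             ≡⟨ ℚ.*-identityʳ (inv x) ⟩
    inv x                  ∎

  *-inv-*-cancelʳ : ∀ x {y} z → y ≢ 0ℚ → x * y * inv (z * y) ≡ x * inv z
  *-inv-*-cancelʳ x {y} z y≢0 = begin
    x * y * inv (z * y)    ≡⟨ ℚ.*-assoc x y (inv (z * y)) ⟩
    x * (y * inv (z * y))  ≡⟨ cong (x *_) (ℚ.*-comm y (inv (z * y))) ⟩
    x * (inv (z * y) * y)  ≡⟨ cong (x *_) (inv-*-cancelʳ z y≢0) ⟩
    x * inv z              ∎

  ^ℕ-+ : ∀ x m n → x ^ℕ (m ℕ.+ n) ≡ x ^ℕ m * x ^ℕ n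
  ^ℕ-+ x zero    n = sym (ℚ.*-identityˡ (x ^ℕ n))
  ^ℕ-+ x (suc m) n = trans (cong (x *_) (^ℕ-+ x m n)) (sym (ℚ.*-assoc x (x ^ℕ m) (x ^ℕ n)))

  ^ℕ-≢0 : ∀ {x} n → x ≢ 0ℚ → x ^ℕ n ≢ 0ℚ
  ^ℕ-≢0 zero    _   ()
  ^ℕ-≢0 (suc n) x≢0 = *-≢0 x≢0 (^ℕ-≢0 n x≢0)

  ^ℤ-⊖ : ∀ {x} → x ≢ 0ℚ → ∀ m n → x ^ℤ (m ⊖ n) ≡ x ^ℕ m * inv (x ^ℕ n)
  ^ℤ-⊖ {x} _   m       zero    = sym (ℚ.*-identityʳ (x ^ℕ m))
  ^ℤ-⊖ {x} _   zero    (suc n) = sym (ℚ.*-identityˡ (inv (x ^ℕ suc n)))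
  ^ℤ-⊖ {x} x≢0 (suc m) (suc n) = begin
    x ^ℤ (suc m ⊖ suc n)                 ≡⟨ cong (x ^ℤ_) (ℤ.[1+m]⊖[1+n]≡m⊖n m n) ⟩
    x ^ℤ (m ⊖ n)                         ≡⟨ ^ℤ-⊖ x≢0 m n ⟩
    y * inv z                            ≡⟨ sym (ℚ.*-identityˡ (y * inv z)) ⟩
    1ℚ * (y * inv z)                     ≡⟨ cong (_* (y * inv z)) (sym (inv-inverseʳ x≢0)) ⟩
    x * inv x * (y * inv z)              ≡⟨ interchange x (inv x) y (inv z) ⟩
    x * y * (inv x * inv z)              ≡⟨ cong (x * y *_) (sym (inv-distrib-* x z)) ⟩
    x ^ℕ suc m * inv (x ^ℕ suc n)        ∎
    where
    y = x ^ℕ m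
    z = x ^ℕ n
    interchange : ∀ a b c d → a * b * (c * d) ≡ a * c * (b * d)
    interchange = solve-∀ ℚ-ring

  ^ℤ-+ : ∀ {x} → x ≢ 0ℚ → ∀ z w → x ^ℤ (z ℤ.+ w) ≡ x ^ℤ z * x ^ℤ w
  ^ℤ-+ {x} _   (+ m)    (+ n)    = ^ℕ-+ x m n
  ^ℤ-+ x≢0 (+ m)    -[1+ n ] = ^ℤ-⊖ x≢0 m (suc n)
  ^ℤ-+ {x} x≢0 -[1+ m ] (+ n) = trans (^ℤ-⊖ x≢0 n (suc m)) (ℚ.*-comm (x ^ℕ n) (inv (x ^ℕ suc m)))
  ^ℤ-+ {x} _   -[1+ m ] -[1+ n ] = begin
    inv (x ^ℕ suc (suc (m ℕ.+ n)))       ≡⟨ cong (λ k → inv (x ^ℕ suc k)) (sym (ℕ.+-suc m n)) ⟩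
    inv (x ^ℕ (suc m ℕ.+ suc n))         ≡⟨ cong inv (^ℕ-+ x (suc m) (suc n)) ⟩
    inv (x ^ℕ suc m * x ^ℕ suc n)        ≡⟨ inv-distrib-* (x ^ℕ suc m) (x ^ℕ suc n) ⟩
    inv (x ^ℕ suc m) * inv (x ^ℕ suc n)  ∎

  1≤∣x^n∣ : ∀ {x} → 1ℚ < ∣ x ∣ → ∀ n → 1ℚ ≤ ∣ x ^ℕ n ∣
  1<∣x^suc∣ : ∀ {x} → 1ℚ < ∣ x ∣ → ∀ n → 1ℚ < ∣ x ^ℕ suc n ∣
  1≤∣x^n∣ _     zero    = ℚ.≤-refl
  1≤∣x^n∣ 1<∣x∣ (suc n) = ℚ.<⇒≤ (1<∣x^suc∣ 1<∣x∣ n)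
  1<∣x^suc∣ {x} 1<∣x∣ n =
    subst (1ℚ <_) (sym (ℚ.∣p*q∣≡∣p∣*∣q∣ x (x ^ℕ n)))
      (ℚ.<-≤-trans 1<∣x∣ (subst (_≤ ∣ x ∣ * ∣ x ^ℕ n ∣) (ℚ.*-identityʳ ∣ x ∣)
        (ℚ.*-monoˡ-≤-nonNeg ∣ x ∣ {{ℚ.∣-∣-nonNeg x}} (1≤∣x^n∣ 1<∣x∣ n))))

  ^suc≢1 : ∀ {x} → 1ℚ < ∣ x ∣ → ∀ n → x ^ℕ suc n ≢ 1ℚ
  ^suc≢1 1<∣x∣ n x^suc≡1 = ℚ.<-irrefl refl (subst (1ℚ <_) (cong ∣_∣ x^suc≡1) (1<∣x^suc∣ 1<∣x∣ n))

  1<∣x∣⇒x≢0 : ∀ {x} → 1ℚ < ∣ x ∣ → x ≢ 0ℚ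
  1<∣x∣⇒x≢0 1<∣x∣ refl = ℚ.<-asym 1<∣x∣ (ℚ.positive⁻¹ 1ℚ)

  -- Agda cannot solve metavariables through ℚ._*_ (it computes), so factors are passed explicitly.
  factors-cong : ∀ x₁ x₃ x₄ {x₂ y₂ x₅ y₅ x₆ y₆} → x₂ ≡ y₂ → x₅ ≡ y₅ → x₆ ≡ y₆ →
    x₁ * x₂ * x₃ * x₄ * x₅ * x₆ ≡ x₁ * y₂ * x₃ * x₄ * y₅ * y₆
  factors-cong _ _ _ refl refl refl = refl

  telescope : ∀ X X′ E σ A A₁ B B₁ C K W u v →
    X * W ≡ E * X′ → A₁ * v ≡ A → B₁ * u ≡ B * v →
    X * σ * A₁ * B₁ * C * K * (W * u) ≡ E * (X′ * σ * A * B * C * K)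
  telescope X X′ E σ A A₁ B B₁ C K W u v XW≡EX′ A₁v≡A B₁u≡Bv = begin
    X * σ * A₁ * B₁ * C * K * (W * u)     ≡⟨ regroup₁ X σ A₁ B₁ C K W u ⟩
    X * W * σ * (A₁ * (B₁ * u)) * C * K   ≡⟨ cong₂ (λ x y → x * σ * (A₁ * y) * C * K) XW≡EX′ B₁u≡Bv ⟩
    E * X′ * σ * (A₁ * (B * v)) * C * K   ≡⟨ regroup₂ E X′ σ A₁ B C K v ⟩
    E * (X′ * σ * (A₁ * v) * B * C * K)   ≡⟨ cong (λ a → E * (X′ * σ * a * B * C * K)) A₁v≡A ⟩
    E * (X′ * σ * A * B * C * K)          ∎
    where
    regroup₁ : ∀ X σ A₁ B₁ C K W u →
      X * σ * A₁ * B₁ * C * K * (W * u) ≡ X * W * σ * (A₁ * (B₁ * u)) * C * K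
    regroup₁ = solve-∀ ℚ-ring
    regroup₂ : ∀ E X′ σ A₁ B C K v →
      E * X′ * σ * (A₁ * (B * v)) * C * K ≡ E * (X′ * σ * (A₁ * v) * B * C * K)
    regroup₂ = solve-∀ ℚ-ring

  cancel-first : ∀ {x x′} y z → x ≡ x′ → (x + y) - (x′ + z) ≡ y - z
  cancel-first {x} y z refl = identity x y z
    where
    identity : ∀ x y z → (x + y) - (x + z) ≡ y - z
    identity = solve-∀ ℚ-ring

  sub-+-step : ∀ x y z s t e → x - y ≡ - (e * z) → s ≡ e * t → x - (y + s) ≡ - (e * (z + t))
  sub-+-step x y z s t e x-y≡-ez s≡et = begin
    x - (y + s)          ≡⟨ cong (λ r → x - (y + r)) s≡et ⟩
    x - (y + e * t)      ≡⟨ split x y (e * t) ⟩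
    (x - y) - e * t      ≡⟨ cong (_- e * t) x-y≡-ez ⟩
    - (e * z) - e * t    ≡⟨ merge e z t ⟩
    - (e * (z + t))      ∎
    where
    split : ∀ x y z → x - (y + z) ≡ (x - y) - z
    split = solve-∀ ℚ-ring
    merge : ∀ e x y → - (e * x) - e * y ≡ - (e * (x + y))
    merge = solve-∀ ℚ-ring

  step-with-optional-term : ∀ (β : Bool) x y z s t e → x - y ≡ - (e * z) → s ≡ e * t →
    x - (if β then y + s else y) ≡ - (e * (if β then z + t else z))
  step-with-optional-term false x y z s t e x-y≡-ez _ = x-y≡-ez
  step-with-optional-term true  x y z s t e         = sub-+-step x y z s t e

  -- Finite sums and products

  sumTo : ℕ → (ℕ → ℚ) → ℚ
  sumTo zero    f = 0ℚ
  sumTo (suc n) f = f 0 + sumTo n (λ k → f (suc k))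

  prodTo : ℕ → (ℕ → ℚ) → ℚ
  prodTo zero    f = 1ℚ
  prodTo (suc n) f = f 0 * prodTo n (λ k → f (suc k))

  foldr-applyUpTo-+ : ∀ (f : ℕ → ℚ) (g : ℕ → ℕ) n →
    foldr (λ k acc → f k + acc) 0ℚ (applyUpTo g n) ≡ sumTo n (λ k → f (g k))
  foldr-applyUpTo-+ f g zero    = refl
  foldr-applyUpTo-+ f g (suc n) = cong (λ t → f (g 0) + t) (foldr-applyUpTo-+ f (λ k → g (suc k)) n)

  foldr-applyUpTo-* : ∀ (f : ℕ → ℚ) (g : ℕ → ℕ) n →
    foldr (λ k acc → f k * acc) 1ℚ (applyUpTo g n) ≡ prodTo n (λ k → f (g k))
  foldr-applyUpTo-* f g zero    = refl
  foldr-applyUpTo-* f g (suc n) = cong (f (g 0) *_) (foldr-applyUpTo-* f (λ k → g (suc k)) n)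

  sumFT≡sumTo : ∀ lo hi f → sumFT lo hi f ≡ sumTo (suc hi ∸ lo) (λ k → f (lo ℕ.+ k))
  sumFT≡sumTo lo hi f = foldr-applyUpTo-+ (λ k → f (lo ℕ.+ k)) (λ k → k) (suc hi ∸ lo)

  prodFT≡prodTo : ∀ lo hi f → prodFT lo hi f ≡ prodTo (suc hi ∸ lo) (λ k → f (lo ℕ.+ k))
  prodFT≡prodTo lo hi f = foldr-applyUpTo-* (λ k → f (lo ℕ.+ k)) (λ k → k) (suc hi ∸ lo)

  sumTo-cong : ∀ n {f g} → (∀ k → k ℕ.< n → f k ≡ g k) → sumTo n f ≡ sumTo n g
  sumTo-cong zero    f≗g = refl
  sumTo-cong (suc n) f≗g =
    cong₂ _+_ (f≗g 0 (ℕ.s≤s ℕ.z≤n)) (sumTo-cong n (λ k k<n → f≗g (suc k) (ℕ.s≤s k<n)))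

  prodTo-cong : ∀ n {f g} → (∀ k → f k ≡ g k) → prodTo n f ≡ prodTo n g
  prodTo-cong zero    f≗g = refl
  prodTo-cong (suc n) f≗g = cong₂ _*_ (f≗g 0) (prodTo-cong n (λ k → f≗g (suc k)))

  sumTo-snoc : ∀ n f → sumTo (suc n) f ≡ sumTo n f + f n
  sumTo-snoc zero    f = ℚ.+-comm (f 0) 0ℚ
  sumTo-snoc (suc n) f =
    trans (cong (λ t → f 0 + t) (sumTo-snoc n (λ k → f (suc k)))) (sym (ℚ.+-assoc (f 0) _ _))

  prodTo-snoc : ∀ n f → prodTo (suc n) f ≡ prodTo n f * f n
  prodTo-snoc zero    f = ℚ.*-comm (f 0) 1ℚ
  prodTo-snoc (suc n) f =
    trans (cong (f 0 *_) (prodTo-snoc n (λ k → f (suc k)))) (sym (ℚ.*-assoc (f 0) _ _))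

  sumTo-scale : ∀ n (f g : ℕ → ℚ) c → (∀ k → k ℕ.< n → f k ≡ c * g k) → sumTo n f ≡ c * sumTo n g
  sumTo-scale zero    f g c _   = sym (ℚ.*-zeroʳ c)
  sumTo-scale (suc n) f g c f≡cg = begin
    f 0 + sumTo n (λ k → f (suc k))          ≡⟨ cong₂ _+_ (f≡cg 0 (ℕ.s≤s ℕ.z≤n))
                                                  (sumTo-scale n _ _ c (λ k k<n → f≡cg (suc k) (ℕ.s≤s k<n))) ⟩
    c * g 0 + c * sumTo n (λ k → g (suc k))  ≡⟨ sym (ℚ.*-distribˡ-+ c (g 0) _) ⟩
    c * sumTo (suc n) g                      ∎

  sumTo-sub : ∀ n (f g h : ℕ → ℚ) c → (∀ k → k ℕ.< n → f k - g k ≡ - (c * h k)) →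
              sumTo n f - sumTo n g ≡ - (c * sumTo n h)
  sumTo-sub zero    f g h c _ = sym (cong -_ (ℚ.*-zeroʳ c))
  sumTo-sub (suc n) f g h c f-g≡-ch = begin
    (f 0 + F) - (g 0 + G)      ≡⟨ regroup (f 0) F (g 0) G ⟩
    (f 0 - g 0) + (F - G)      ≡⟨ cong₂ _+_ (f-g≡-ch 0 (ℕ.s≤s ℕ.z≤n))
                                    (sumTo-sub n _ _ _ c (λ k k<n → f-g≡-ch (suc k) (ℕ.s≤s k<n))) ⟩
    - (c * h 0) + - (c * H)    ≡⟨ factor c (h 0) H ⟩
    - (c * sumTo (suc n) h)    ∎
    where
    F = sumTo n (λ k → f (suc k))
    G = sumTo n (λ k → g (suc k))
    H = sumTo n (λ k → h (suc k))
    regroup : ∀ a b c d → (a + b) - (c + d) ≡ (a - c) + (b - d)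
    regroup = solve-∀ ℚ-ring
    factor : ∀ c a b → - (c * a) + - (c * b) ≡ - (c * (a + b))
    factor = solve-∀ ℚ-ring

  prodFT-shift : ∀ lo hi f → lo ℕ.≤ suc hi → prodFT (suc lo) (suc hi) f * f lo ≡ prodFT lo hi f * f (suc hi)
  prodFT-shift lo hi f lo≤1+hi = begin
    prodFT (suc lo) (suc hi) f * f lo
      ≡⟨ cong₂ _*_ (prodFT≡prodTo (suc lo) (suc hi) f) (cong f (sym (ℕ.+-identityʳ lo))) ⟩
    prodTo m (λ k → f (suc lo ℕ.+ k)) * g 0
      ≡⟨ cong (_* g 0) (prodTo-cong m (λ k → cong f (sym (ℕ.+-suc lo k)))) ⟩
    prodTo m (λ k → g (suc k)) * g 0
      ≡⟨ ℚ.*-comm (prodTo m (λ k → g (suc k))) (g 0) ⟩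
    prodTo (suc m) g
      ≡⟨ prodTo-snoc m g ⟩
    prodTo m g * g m
      ≡⟨ cong₂ _*_ (sym (prodFT≡prodTo lo hi f)) (cong f (ℕ.m+[n∸m]≡n lo≤1+hi)) ⟩
    prodFT lo hi f * f (suc hi) ∎
    where
    m = suc hi ∸ lo
    g = λ k → f (lo ℕ.+ k)

  -- Exponents

  [z+2]/ℕ2 : ∀ z → (z ℤ.+ + 2) /ℕ 2 ≡ z /ℕ 2 ℤ.+ + 1
  [z+2]/ℕ2 (+ n)               = cong +_ (+-distrib-/-∣ʳ n ∣-refl)
  [z+2]/ℕ2 -[1+ 0 ]            = refl
  [z+2]/ℕ2 -[1+ 1 ]            = refl
  -- Both divisions branch on the remainder (m + 1) % 2, which is definitionally (m + 3) % 2.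
  [z+2]/ℕ2 -[1+ suc (suc m) ] with suc m ℕ.% 2 | +-distrib-/-∣ˡ {2} (suc m) ∣-refl
  ... | zero  | [m+3]/2≡1+[m+1]/2 rewrite [m+3]/2≡1+[m+1]/2 =
    trans (sym (ℤ.⊖-swap 0 (suc m ℕ./ 2))) (sym (ℤ.[1+m]⊖[1+n]≡m⊖n 0 (suc m ℕ./ 2)))
  ... | suc _ | [m+3]/2≡1+[m+1]/2 rewrite [m+3]/2≡1+[m+1]/2 = refl

  [z+2n]/ℕ2 : ∀ z n → (z ℤ.+ + 2 ℤ.* + n) /ℕ 2 ≡ z /ℕ 2 ℤ.+ + n
  [z+2n]/ℕ2 z zero    = trans (cong (_/ℕ 2) (ℤ.+-identityʳ z)) (sym (ℤ.+-identityʳ (z /ℕ 2)))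
  [z+2n]/ℕ2 z (suc n) = begin
    (z ℤ.+ + 2 ℤ.* + suc n) /ℕ 2          ≡⟨ cong (_/ℕ 2) (step z (+ n)) ⟩
    (z ℤ.+ + 2 ℤ.* + n ℤ.+ + 2) /ℕ 2      ≡⟨ [z+2]/ℕ2 (z ℤ.+ + 2 ℤ.* + n) ⟩
    (z ℤ.+ + 2 ℤ.* + n) /ℕ 2 ℤ.+ + 1      ≡⟨ cong (ℤ._+ + 1) ([z+2n]/ℕ2 z n) ⟩
    z /ℕ 2 ℤ.+ + n ℤ.+ + 1                ≡⟨ ℤ.+-assoc (z /ℕ 2) (+ n) (+ 1) ⟩
    z /ℕ 2 ℤ.+ + (n ℕ.+ 1)                ≡⟨ cong (λ k → z /ℕ 2 ℤ.+ + k) (ℕ.+-comm n 1) ⟩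
    z /ℕ 2 ℤ.+ + suc n                    ∎
    where
    step : ∀ z n → z ℤ.+ + 2 ℤ.* (+ 1 ℤ.+ n) ≡ z ℤ.+ + 2 ℤ.* n ℤ.+ + 2
    step = ℤ.solve-∀

  [z+2w]/ℕ2 : ∀ z w → (z ℤ.+ + 2 ℤ.* w) /ℕ 2 ≡ z /ℕ 2 ℤ.+ w
  [z+2w]/ℕ2 z (+ n)    = [z+2n]/ℕ2 z n
  [z+2w]/ℕ2 z -[1+ n ] = begin
    z′ /ℕ 2                                 ≡⟨ cancel (z′ /ℕ 2) (+ suc n) ⟩
    z′ /ℕ 2 ℤ.+ + suc n ℤ.+ -[1+ n ]        ≡⟨ cong (ℤ._+ -[1+ n ]) (sym ([z+2n]/ℕ2 z′ (suc n))) ⟩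
    (z′ ℤ.+ + 2 ℤ.* + suc n) /ℕ 2 ℤ.+ -[1+ n ] ≡⟨ cong (λ t → t /ℕ 2 ℤ.+ -[1+ n ]) (restore z (+ suc n)) ⟩
    z /ℕ 2 ℤ.+ -[1+ n ]                     ∎
    where
    z′ = z ℤ.+ + 2 ℤ.* -[1+ n ]
    cancel : ∀ a b → a ≡ a ℤ.+ b ℤ.+ ℤ.- b
    cancel = ℤ.solve-∀
    restore : ∀ z m → z ℤ.+ + 2 ℤ.* ℤ.- m ℤ.+ + 2 ℤ.* m ≡ z
    restore = ℤ.solve-∀

  +suc : ∀ m → + suc m ≡ + 1 ℤ.+ + m
  +suc m = ℤ.pos-+ 1 m

  +[m∸n] : ∀ {m n} → n ℕ.≤ m → + (m ∸ n) ≡ + m ℤ.- + n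
  +[m∸n] {m} {n} n≤m = sym (trans (ℤ.[+m]-[+n]≡m⊖n m n) (ℤ.⊖-≥ n≤m))

  halfProduct : ℕ → ℕ → ℕ → ℤ
  halfProduct n i s = ((+ i ℤ.- + s) ℤ.* (+ 2 ℤ.* + n ℤ.- + i ℤ.+ + s ℤ.+ + 1)) /ℕ 2

  Mexponent : ℕ → ℕ → ℕ → ℕ → ℕ → ℤ
  Mexponent n h c i s =
    + n ℤ.* (+ h ℤ.- + i) ℤ.+ halfProduct n i s ℤ.- + h ℤ.* + h
    ℤ.+ + s ℤ.* (+ 2 ℤ.* + n ℤ.- + 2 ℤ.* + c ℤ.- + s)

  stepExponent : ℕ → ℕ → ℕ → ℕ → ℤ
  stepExponent n h b c = + 2 ℤ.* + n ℤ.- + h ℤ.- + 1 ℤ.- + b ℤ.- + 2 ℤ.* + c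

  halfProduct-suc : ∀ n i s → halfProduct (suc n) (suc i) (suc s) ≡ halfProduct n i s ℤ.+ (+ i ℤ.- + s)
  halfProduct-suc n i s = begin
    halfProduct (suc n) (suc i) (suc s)   ≡⟨ cong (_/ℕ 2) product-suc ⟩
    (p ℤ.+ + 2 ℤ.* (+ i ℤ.- + s)) /ℕ 2    ≡⟨ [z+2w]/ℕ2 p (+ i ℤ.- + s) ⟩
    halfProduct n i s ℤ.+ (+ i ℤ.- + s)   ∎
    where
    p = (+ i ℤ.- + s) ℤ.* (+ 2 ℤ.* + n ℤ.- + i ℤ.+ + s ℤ.+ + 1)
    identity : ∀ n i s →
      (+ 1 ℤ.+ i ℤ.- (+ 1 ℤ.+ s)) ℤ.* (+ 2 ℤ.* (+ 1 ℤ.+ n) ℤ.- (+ 1 ℤ.+ i) ℤ.+ (+ 1 ℤ.+ s) ℤ.+ + 1)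
        ≡ (i ℤ.- s) ℤ.* (+ 2 ℤ.* n ℤ.- i ℤ.+ s ℤ.+ + 1) ℤ.+ + 2 ℤ.* (i ℤ.- s)
    identity = ℤ.solve-∀
    product-suc : (+ suc i ℤ.- + suc s) ℤ.* (+ 2 ℤ.* + suc n ℤ.- + suc i ℤ.+ + suc s ℤ.+ + 1)
                  ≡ p ℤ.+ + 2 ℤ.* (+ i ℤ.- + s)
    product-suc rewrite +suc n | +suc i | +suc s = identity (+ n) (+ i) (+ s)

  Mexponent-step : ∀ n h b c i s → s ℕ.≤ b →
    Mexponent (suc n) (suc h) c (suc i) (suc s) ℤ.+ ℤ.- (+ (b ∸ s))
      ≡ stepExponent (suc n) (suc h) b c ℤ.+ Mexponent n h c i s
  Mexponent-step n h b c i s s≤b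
    rewrite halfProduct-suc n i s | +[m∸n] s≤b | +suc n | +suc h | +suc i | +suc s =
      identity (+ n) (+ h) (+ b) (+ c) (+ i) (+ s) (halfProduct n i s)
    where
    identity : ∀ n h b c i s t →
      (+ 1 ℤ.+ n) ℤ.* ((+ 1 ℤ.+ h) ℤ.- (+ 1 ℤ.+ i)) ℤ.+ (t ℤ.+ (i ℤ.- s)) ℤ.- (+ 1 ℤ.+ h) ℤ.* (+ 1 ℤ.+ h)
        ℤ.+ (+ 1 ℤ.+ s) ℤ.* (+ 2 ℤ.* (+ 1 ℤ.+ n) ℤ.- + 2 ℤ.* c ℤ.- (+ 1 ℤ.+ s)) ℤ.+ ℤ.- (b ℤ.- s)
      ≡ + 2 ℤ.* (+ 1 ℤ.+ n) ℤ.- (+ 1 ℤ.+ h) ℤ.- + 1 ℤ.- b ℤ.- + 2 ℤ.* c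
        ℤ.+ (n ℤ.* (h ℤ.- i) ℤ.+ t ℤ.- h ℤ.* h ℤ.+ s ℤ.* (+ 2 ℤ.* n ℤ.- + 2 ℤ.* c ℤ.- s))
    identity = ℤ.solve-∀

  triangle : ℕ → ℕ → ℤ
  triangle h b = ((+ h ℤ.- + b) ℤ.* (+ h ℤ.+ + b ℤ.+ + 1)) /ℕ 2

  triangle-step : ∀ b c h →
    ℤ.- triangle (suc h) (suc b) ≡ stepExponent (suc (b ℕ.+ c)) (suc h) b c ℤ.+ ℤ.- triangle h b
  triangle-step b c h = begin
    ℤ.- triangle (suc h) (suc b)                      ≡⟨ cong (λ t → ℤ.- (t /ℕ 2)) product-suc ⟩
    ℤ.- ((p ℤ.+ + 2 ℤ.* (+ h ℤ.- + b)) /ℕ 2)          ≡⟨ cong ℤ.-_ ([z+2w]/ℕ2 p (+ h ℤ.- + b)) ⟩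
    ℤ.- (triangle h b ℤ.+ (+ h ℤ.- + b))              ≡⟨ regroup (triangle h b) ⟩
    stepExponent (suc (b ℕ.+ c)) (suc h) b c ℤ.+ ℤ.- triangle h b ∎
    where
    p = (+ h ℤ.- + b) ℤ.* (+ h ℤ.+ + b ℤ.+ + 1)
    product-identity : ∀ h b →
      (+ 1 ℤ.+ h ℤ.- (+ 1 ℤ.+ b)) ℤ.* (+ 1 ℤ.+ h ℤ.+ (+ 1 ℤ.+ b) ℤ.+ + 1)
        ≡ (h ℤ.- b) ℤ.* (h ℤ.+ b ℤ.+ + 1) ℤ.+ + 2 ℤ.* (h ℤ.- b)
    product-identity = ℤ.solve-∀
    product-suc : (+ suc h ℤ.- + suc b) ℤ.* (+ suc h ℤ.+ + suc b ℤ.+ + 1) ≡ p ℤ.+ + 2 ℤ.* (+ h ℤ.- + b)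
    product-suc rewrite +suc h | +suc b = product-identity (+ h) (+ b)
    exponent-identity : ∀ h b c t →
      ℤ.- (t ℤ.+ (h ℤ.- b))
        ≡ + 2 ℤ.* (+ 1 ℤ.+ (b ℤ.+ c)) ℤ.- (+ 1 ℤ.+ h) ℤ.- + 1 ℤ.- b ℤ.- + 2 ℤ.* c ℤ.+ ℤ.- t
    exponent-identity = ℤ.solve-∀
    regroup : ∀ t → ℤ.- (t ℤ.+ (+ h ℤ.- + b)) ≡ stepExponent (suc (b ℕ.+ c)) (suc h) b c ℤ.+ ℤ.- t
    regroup t rewrite +suc (b ℕ.+ c) | +suc h | ℤ.pos-+ b c = exponent-identity (+ h) (+ b) (+ c) t

  -- The recursion for D

  module _ (q : ℕ) (1<∣-q∣ : 1ℚ < ∣ mq q ∣) where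

    -q≢0 : mq q ≢ 0ℚ
    -q≢0 = 1<∣x∣⇒x≢0 1<∣-q∣

    u : ℕ → ℚ
    u l = 1ℚ - mqpow q (ℤ.- (+ l))

    u≢0 : ∀ l → u (suc l) ≢ 0ℚ
    u≢0 l u≡0 = ^suc≢1 1<∣-q∣ l (begin
      y            ≡⟨ sym (ℚ.*-identityʳ y) ⟩
      y * 1ℚ       ≡⟨ cong (y *_) (sym inv-y≡1) ⟩
      y * inv y    ≡⟨ inv-inverseʳ (^ℕ-≢0 (suc l) -q≢0) ⟩
      1ℚ           ∎)
      where
      y = mq q ^ℕ suc l
      1-[1-t]≡t : ∀ t → 1ℚ - (1ℚ - t) ≡ t
      1-[1-t]≡t = solve-∀ ℚ-ring
      inv-y≡1 : inv y ≡ 1ℚ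
      inv-y≡1 = trans (sym (1-[1-t]≡t (inv y))) (cong (λ t → 1ℚ - t) u≡0)

    u-diff : ∀ b s → s ℕ.≤ b → u (b ∸ s) - u (suc b) ≡ - (mqpow q (ℤ.- (+ (b ∸ s))) * u (suc s))
    u-diff b s s≤b = begin
      (1ℚ - W) - (1ℚ - mqpow q (ℤ.- (+ suc b)))  ≡⟨ cong (λ t → (1ℚ - W) - (1ℚ - t)) -[1+b]-split ⟩
      (1ℚ - W) - (1ℚ - W * V)                    ≡⟨ identity W V ⟩
      - (W * (1ℚ - V))                           ∎
      where
      W = mqpow q (ℤ.- (+ (b ∸ s)))
      V = mqpow q (ℤ.- (+ suc s))
      exponent-identity : ∀ b s → ℤ.- (+ 1 ℤ.+ b) ≡ ℤ.- (b ℤ.- s) ℤ.+ ℤ.- (+ 1 ℤ.+ s)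
      exponent-identity = ℤ.solve-∀
      exponent-split : ℤ.- (+ suc b) ≡ ℤ.- (+ (b ∸ s)) ℤ.+ ℤ.- (+ suc s)
      exponent-split rewrite +[m∸n] s≤b | +suc b | +suc s = exponent-identity (+ b) (+ s)
      -[1+b]-split : mqpow q (ℤ.- (+ suc b)) ≡ W * V
      -[1+b]-split = trans (cong (mqpow q) exponent-split) (^ℤ-+ -q≢0 (ℤ.- (+ (b ∸ s))) (ℤ.- (+ suc s)))
      identity : ∀ W V → (1ℚ - W) - (1ℚ - W * V) ≡ - (W * (1ℚ - V))
      identity = solve-∀ ℚ-ring

    P-suc : ∀ k → P q (suc k) ≡ P q k * u (suc k)
    P-suc k = begin
      P q (suc k)                             ≡⟨ prodFT≡prodTo 1 (suc k) u ⟩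
      prodTo (suc k) (λ j → u (suc j))        ≡⟨ prodTo-snoc k (λ j → u (suc j)) ⟩
      prodTo k (λ j → u (suc j)) * u (suc k)  ≡⟨ cong (_* u (suc k)) (sym (prodFT≡prodTo 1 k u)) ⟩
      P q k * u (suc k)                       ∎

    P≢0 : ∀ k → P q k ≢ 0ℚ
    P≢0 zero    ()
    P≢0 (suc k) = subst (_≢ 0ℚ) (sym (P-suc k)) (*-≢0 (P≢0 k) (u≢0 k))

    P-∸-suc : ∀ b s → s ℕ.< b → P q (b ∸ s) ≡ P q (b ∸ suc s) * u (b ∸ s)
    P-∸-suc b s s<b =
      subst (λ k → P q k ≡ P q (b ∸ suc s) * u k) (sym (ℕ.+-∸-assoc 1 s<b)) (P-suc (b ∸ suc s))

    stepFactor : ℕ → ℕ → ℕ → ℕ → ℚ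
    stepFactor n h b c = mqpow q (stepExponent n h b c)

    nhRatio : ℕ → ℕ → ℕ → ℚ
    nhRatio n h i = P q (n ∸ i) * inv (P q (n ∸ h) * P q h)

    hisRatio : ℕ → ℕ → ℕ → ℚ
    hisRatio h i s = prodFT (suc s) h u * inv (P q (h ∸ i) * P q (i ∸ s))

    bcRatio : ℕ → ℕ → ℕ → ℕ → ℚ
    bcRatio b c i s = P q c * P q b * inv (P q (c ℕ.+ s ∸ i) * P q (b ∸ s))

    M-factors : ∀ n h a b c i s →
      M q n h a b c i s
        ≡ mqpow q (Mexponent n h c i s) * sgn (i ℕ.+ h) * nhRatio n h i * hisRatio h i s
          * bcRatio b c i s * 𝒞 q (h ℕ.+ 1 ∸ s) a (b ∸ s) (c ℕ.+ s ∸ i)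
    M-factors n h a b c i s = refl

    sgn-step : ∀ i h → sgn (suc i ℕ.+ suc h) ≡ sgn (i ℕ.+ h)
    sgn-step i h = trans (cong (λ k → sgn (suc k)) (ℕ.+-suc i h)) (identity (sgn (i ℕ.+ h)))
      where
      identity : ∀ y → - 1ℚ * (- 1ℚ * y) ≡ y
      identity = solve-∀ ℚ-ring

    exponential-step : ∀ n h b c i s → s ℕ.≤ b →
      mqpow q (Mexponent (suc n) (suc h) c (suc i) (suc s)) * mqpow q (ℤ.- (+ (b ∸ s)))
        ≡ stepFactor (suc n) (suc h) b c * mqpow q (Mexponent n h c i s)
    exponential-step n h b c i s s≤b = begin
      mqpow q e₁ * mqpow q (ℤ.- (+ (b ∸ s)))   ≡⟨ sym (^ℤ-+ -q≢0 e₁ (ℤ.- (+ (b ∸ s)))) ⟩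
      mqpow q (e₁ ℤ.+ ℤ.- (+ (b ∸ s)))         ≡⟨ cong (mqpow q) (Mexponent-step n h b c i s s≤b) ⟩
      mqpow q (stepExponent (suc n) (suc h) b c ℤ.+ e)
        ≡⟨ ^ℤ-+ -q≢0 (stepExponent (suc n) (suc h) b c) e ⟩
      stepFactor (suc n) (suc h) b c * mqpow q e ∎
      where
      e₁ = Mexponent (suc n) (suc h) c (suc i) (suc s)
      e = Mexponent n h c i s

    nhRatio-step : ∀ n h i → nhRatio (suc n) (suc h) (suc i) * u (suc h) ≡ nhRatio n h i
    nhRatio-step n h i = begin
      A * inv (B * P q (suc h)) * v      ≡⟨ cong (λ t → A * inv (B * t) * v) (P-suc h) ⟩
      A * inv (B * (C * v)) * v          ≡⟨ cong (λ t → A * inv t * v) (sym (ℚ.*-assoc B C v)) ⟩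
      A * inv (B * C * v) * v            ≡⟨ ℚ.*-assoc A (inv (B * C * v)) v ⟩
      A * (inv (B * C * v) * v)          ≡⟨ cong (A *_) (inv-*-cancelʳ (B * C) (u≢0 h)) ⟩
      A * inv (B * C)                    ∎
      where
      A = P q (n ∸ i)
      B = P q (n ∸ h)
      C = P q h
      v = u (suc h)

    hisRatio-step : ∀ h i s → s ℕ.≤ h →
      hisRatio (suc h) (suc i) (suc s) * u (suc s) ≡ hisRatio h i s * u (suc h)
    hisRatio-step h i s s≤h = begin
      Q₁ * I * u (suc s)        ≡⟨ swap Q₁ I (u (suc s)) ⟩
      Q₁ * u (suc s) * I        ≡⟨ cong (_* I) (prodFT-shift (suc s) h u (ℕ.s≤s s≤h)) ⟩
      Q * u (suc h) * I         ≡⟨ swap Q (u (suc h)) I ⟩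
      Q * I * u (suc h)         ∎
      where
      Q₁ = prodFT (suc (suc s)) (suc h) u
      Q = prodFT (suc s) h u
      I = inv (P q (h ∸ i) * P q (i ∸ s))
      swap : ∀ x y z → x * y * z ≡ x * z * y
      swap = solve-∀ ℚ-ring

    c+[1+s]∸[1+i] : ∀ c s i → c ℕ.+ suc s ∸ suc i ≡ c ℕ.+ s ∸ i
    c+[1+s]∸[1+i] c s i = cong (_∸ suc i) (ℕ.+-suc c s)

    bcRatio-suc-b : ∀ b c i s → bcRatio (suc b) c (suc i) (suc s) ≡ bcRatio b c i s * u (suc b)
    bcRatio-suc-b b c i s = begin
      P q c * P q (suc b) * inv (P q (c ℕ.+ suc s ∸ suc i) * P q (b ∸ s))
        ≡⟨ cong₂ (λ x z → P q c * x * inv (P q z * P q (b ∸ s))) (P-suc b) (c+[1+s]∸[1+i] c s i) ⟩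
      P q c * (P q b * u (suc b)) * I
        ≡⟨ pull (P q c) (P q b) (u (suc b)) I ⟩
      P q c * P q b * I * u (suc b) ∎
      where
      I = inv (P q (c ℕ.+ s ∸ i) * P q (b ∸ s))
      pull : ∀ x y v i → x * (y * v) * i ≡ x * y * i * v
      pull = solve-∀ ℚ-ring

    bcRatio-suc-s : ∀ b c i s → s ℕ.< b → bcRatio b c (suc i) (suc s) ≡ bcRatio b c i s * u (b ∸ s)
    bcRatio-suc-s b c i s s<b = begin
      P q c * P q b * inv (P q (c ℕ.+ suc s ∸ suc i) * R)
        ≡⟨ cong (λ z → P q c * P q b * inv (P q z * R)) (c+[1+s]∸[1+i] c s i) ⟩
      P q c * P q b * inv (Z * R)
        ≡⟨ cong (P q c * P q b *_) (sym (inv-*-cancelʳ (Z * R) v≢0)) ⟩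
      P q c * P q b * (inv (Z * R * v) * v)
        ≡⟨ cong (λ t → P q c * P q b * (inv t * v)) (ℚ.*-assoc Z R v) ⟩
      P q c * P q b * (inv (Z * (R * v)) * v)
        ≡⟨ cong (λ t → P q c * P q b * (inv (Z * t) * v)) (sym (P-∸-suc b s s<b)) ⟩
      P q c * P q b * (inv (Z * P q (b ∸ s)) * v)
        ≡⟨ sym (ℚ.*-assoc (P q c * P q b) (inv (Z * P q (b ∸ s))) v) ⟩
      P q c * P q b * inv (Z * P q (b ∸ s)) * v ∎
      where
      Z = P q (c ℕ.+ s ∸ i)
      R = P q (b ∸ suc s)
      v = u (b ∸ s)
      v≢0 : v ≢ 0ℚ
      v≢0 = subst (λ k → u k ≢ 0ℚ) (sym (ℕ.+-∸-assoc 1 s<b)) (u≢0 (b ∸ suc s))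

    𝒞-shift : ∀ j a b z → 𝒞 q j (suc a) b z ≡ 𝒞 q j a (suc b) z
    𝒞-shift j zero    b z = refl
    𝒞-shift j (suc a) b z =
      cong (λ t → sgn (suc j) * prodFT 1 (t ∸ 1) (λ i → 1ℚ - mqpow q (+ i))) (sym (ℕ.+-suc (suc a) b))

    commonFactor : ℕ → ℕ → ℕ → ℕ → ℕ → ℕ → ℕ → ℚ
    commonFactor n h a b c i s =
      mqpow q (Mexponent (suc n) (suc h) c (suc i) (suc s)) * sgn (i ℕ.+ h)
      * nhRatio (suc n) (suc h) (suc i) * hisRatio (suc h) (suc i) (suc s)
      * bcRatio b c i s * 𝒞 q (h ℕ.+ 1 ∸ s) a (b ∸ s) (c ℕ.+ s ∸ i)

    M≡commonFactor : ∀ n h a b c i s a′ b′ y →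
      bcRatio b′ c (suc i) (suc s) ≡ bcRatio b c i s * y →
      𝒞 q (h ℕ.+ 1 ∸ s) a′ (b′ ∸ suc s) (c ℕ.+ suc s ∸ suc i) ≡ 𝒞 q (h ℕ.+ 1 ∸ s) a (b ∸ s) (c ℕ.+ s ∸ i) →
      M q (suc n) (suc h) a′ b′ c (suc i) (suc s) ≡ commonFactor n h a b c i s * y
    M≡commonFactor n h a b c i s a′ b′ y bc≡ 𝒞≡ = begin
      M q (suc n) (suc h) a′ b′ c (suc i) (suc s)      ≡⟨ factors-cong X A B (sgn-step i h) bc≡ 𝒞≡ ⟩
      X * σ * A * B * (C * y) * K                       ≡⟨ pull X σ A B C K y ⟩
      commonFactor n h a b c i s * y                         ∎
      where
      X = mqpow q (Mexponent (suc n) (suc h) c (suc i) (suc s))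
      σ = sgn (i ℕ.+ h)
      A = nhRatio (suc n) (suc h) (suc i)
      B = hisRatio (suc h) (suc i) (suc s)
      C = bcRatio b c i s
      K = 𝒞 q (h ℕ.+ 1 ∸ s) a (b ∸ s) (c ℕ.+ s ∸ i)
      pull : ∀ x₁ x₂ x₃ x₄ x₅ x₆ y → x₁ * x₂ * x₃ * x₄ * (x₅ * y) * x₆ ≡ x₁ * x₂ * x₃ * x₄ * x₅ * x₆ * y
      pull = solve-∀ ℚ-ring

    M-suc-a : ∀ n h a b c i s → s ℕ.< b →
      M q (suc n) (suc h) (suc a) b c (suc i) (suc s) ≡ commonFactor n h a b c i s * u (b ∸ s)
    M-suc-a n h a b c i s s<b =
      M≡commonFactor n h a b c i s (suc a) b (u (b ∸ s)) (bcRatio-suc-s b c i s s<b)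
        (trans (𝒞-shift j a (b ∸ suc s) (c ℕ.+ suc s ∸ suc i))
               (cong₂ (𝒞 q j a) (sym (ℕ.+-∸-assoc 1 s<b)) (c+[1+s]∸[1+i] c s i)))
      where
      j = h ℕ.+ 1 ∸ s

    M-suc-b : ∀ n h a b c i s →
      M q (suc n) (suc h) a (suc b) c (suc i) (suc s) ≡ commonFactor n h a b c i s * u (suc b)
    M-suc-b n h a b c i s =
      M≡commonFactor n h a b c i s a (suc b) (u (suc b)) (bcRatio-suc-b b c i s)
        (cong (𝒞 q (h ℕ.+ 1 ∸ s) a (b ∸ s)) (c+[1+s]∸[1+i] c s i))

    commonFactor-scaled : ∀ n h a b c i s → s ℕ.≤ b → s ℕ.≤ h →
      commonFactor n h a b c i s * (mqpow q (ℤ.- (+ (b ∸ s))) * u (suc s))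
        ≡ stepFactor (suc n) (suc h) b c * M q n h a b c i s
    commonFactor-scaled n h a b c i s s≤b s≤h =
      trans (telescope
               (mqpow q (Mexponent (suc n) (suc h) c (suc i) (suc s))) (mqpow q (Mexponent n h c i s))
               (stepFactor (suc n) (suc h) b c) (sgn (i ℕ.+ h))
               (nhRatio n h i) (nhRatio (suc n) (suc h) (suc i))
               (hisRatio h i s) (hisRatio (suc h) (suc i) (suc s))
               (bcRatio b c i s) (𝒞 q (h ℕ.+ 1 ∸ s) a (b ∸ s) (c ℕ.+ s ∸ i))
               (mqpow q (ℤ.- (+ (b ∸ s)))) (u (suc s)) (u (suc h))
               (exponential-step n h b c i s s≤b) (nhRatio-step n h i) (hisRatio-step h i s s≤h))
            (cong (stepFactor (suc n) (suc h) b c *_) (sym (M-factors n h a b c i s)))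

    M-step : ∀ n h a b c i s → s ℕ.< b → s ℕ.≤ h →
      M q (suc n) (suc h) (suc a) b c (suc i) (suc s) - M q (suc n) (suc h) a (suc b) c (suc i) (suc s)
        ≡ - (stepFactor (suc n) (suc h) b c * M q n h a b c i s)
    M-step n h a b c i s s<b s≤h = begin
      M q (suc n) (suc h) (suc a) b c (suc i) (suc s) - M q (suc n) (suc h) a (suc b) c (suc i) (suc s)
        ≡⟨ cong₂ _-_ (M-suc-a n h a b c i s s<b) (M-suc-b n h a b c i s) ⟩
      T * u (b ∸ s) - T * u (suc b)      ≡⟨ factor T (u (b ∸ s)) (u (suc b)) ⟩
      T * (u (b ∸ s) - u (suc b))        ≡⟨ cong (T *_) (u-diff b s (ℕ.<⇒≤ s<b)) ⟩
      T * - (W * u (suc s))              ≡⟨ sym (ℚ.neg-distribʳ-* T (W * u (suc s))) ⟩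
      - (T * (W * u (suc s)))            ≡⟨ cong -_ (commonFactor-scaled n h a b c i s (ℕ.<⇒≤ s<b) s≤h) ⟩
      - (stepFactor (suc n) (suc h) b c * M q n h a b c i s) ∎
      where
      T = commonFactor n h a b c i s
      W = mqpow q (ℤ.- (+ (b ∸ s)))
      factor : ∀ t x y → t * x - t * y ≡ t * (x - y)
      factor = solve-∀ ℚ-ring

    M-step-last : ∀ n h a b c i → b ℕ.≤ h →
      M q (suc n) (suc h) a (suc b) c (suc i) (suc b) ≡ stepFactor (suc n) (suc h) b c * M q n h a b c i b
    M-step-last n h a b c i b≤h = begin
      M q (suc n) (suc h) a (suc b) c (suc i) (suc b)  ≡⟨ M-suc-b n h a b c i b ⟩
      T * u (suc b)                                    ≡⟨ cong (T *_) (sym (ℚ.*-identityˡ (u (suc b)))) ⟩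
      T * (1ℚ * u (suc b))
        ≡⟨ cong (λ k → T * (mqpow q (ℤ.- (+ k)) * u (suc b))) (sym (ℕ.n∸n≡0 b)) ⟩
      T * (mqpow q (ℤ.- (+ (b ∸ b))) * u (suc b))      ≡⟨ commonFactor-scaled n h a b c i b ℕ.≤-refl b≤h ⟩
      stepFactor (suc n) (suc h) b c * M q n h a b c i b ∎
      where
      T = commonFactor n h a b c i b

    M-s₀ : ∀ n h a b c i → M q n h (suc a) b c i 0 ≡ M q n h a (suc b) c i 0
    M-s₀ n h a b c i =
      factors-cong (mqpow q (Mexponent n h c i 0)) (nhRatio n h i) (hisRatio h i 0) refl
        (trans (*-inv-*-cancelʳ (P q c) (P q (c ℕ.+ 0 ∸ i)) (P≢0 b))
               (sym (*-inv-*-cancelʳ (P q c) (P q (c ℕ.+ 0 ∸ i)) (P≢0 (suc b)))))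
        (𝒞-shift (h ℕ.+ 1 ∸ 0) a b (c ℕ.+ 0 ∸ i))

    row : ℕ → ℕ → ℕ → ℕ → ℕ → ℕ → ℚ
    row n h a b c s = sumTo (suc ((s ℕ.+ c) ⊓ h) ∸ s) (λ k → M q n h a b c (s ℕ.+ k) s)

    DSum-rows : ∀ n h a b c → DSum q n h a b c ≡ sumTo (suc (h ⊓ b)) (row n h a b c)
    DSum-rows n h a b c =
      trans (sumFT≡sumTo 0 (h ⊓ b) (λ s → sumFT s ((s ℕ.+ c) ⊓ h) (λ i → M q n h a b c i s)))
            (sumTo-cong (suc (h ⊓ b)) (λ s _ → sumFT≡sumTo s ((s ℕ.+ c) ⊓ h) (λ i → M q n h a b c i s)))

    row-s₀ : ∀ n h a b c → row n h (suc a) b c 0 ≡ row n h a (suc b) c 0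
    row-s₀ n h a b c = sumTo-cong (suc (c ⊓ h)) (λ k _ → M-s₀ n h a b c k)

    row-step : ∀ n h a b c s → s ℕ.< b → s ℕ.≤ h →
      row (suc n) (suc h) (suc a) b c (suc s) - row (suc n) (suc h) a (suc b) c (suc s)
        ≡ - (stepFactor (suc n) (suc h) b c * row n h a b c s)
    row-step n h a b c s s<b s≤h =
      sumTo-sub (suc ((s ℕ.+ c) ⊓ h) ∸ s)
        (λ k → M q (suc n) (suc h) (suc a) b c (suc (s ℕ.+ k)) (suc s))
        (λ k → M q (suc n) (suc h) a (suc b) c (suc (s ℕ.+ k)) (suc s))
        (λ k → M q n h a b c (s ℕ.+ k) s)
        (stepFactor (suc n) (suc h) b c)
        (λ k _ → M-step n h a b c (s ℕ.+ k) s s<b s≤h)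

    row-last : ∀ n h a b c → b ℕ.≤ h →
      row (suc n) (suc h) a (suc b) c (suc b) ≡ stepFactor (suc n) (suc h) b c * row n h a b c b
    row-last n h a b c b≤h =
      sumTo-scale (suc ((b ℕ.+ c) ⊓ h) ∸ b)
        (λ k → M q (suc n) (suc h) a (suc b) c (suc (b ℕ.+ k)) (suc b))
        (λ k → M q n h a b c (b ℕ.+ k) b)
        (stepFactor (suc n) (suc h) b c)
        (λ k _ → M-step-last n h a b c (b ℕ.+ k) b≤h)

    shifted-rows-≤ : ∀ n h a b c → b ℕ.≤ h →
      sumTo (suc h ⊓ b) (λ s → row (suc n) (suc h) (suc a) b c (suc s))
        - sumTo (suc (h ⊓ b)) (λ s → row (suc n) (suc h) a (suc b) c (suc s))
        ≡ - (stepFactor (suc n) (suc h) b c * sumTo (suc (h ⊓ b)) (row n h a b c))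
    shifted-rows-≤ n h a b c b≤h = begin
      sumTo (suc h ⊓ b) R₁ - sumTo (suc (h ⊓ b)) R₂
        ≡⟨ cong₂ (λ m m′ → sumTo m R₁ - sumTo (suc m′) R₂) [1+h]⊓b≡b h⊓b≡b ⟩
      sumTo b R₁ - sumTo (suc b) R₂           ≡⟨ cong (λ t → sumTo b R₁ - t) (sumTo-snoc b R₂) ⟩
      sumTo b R₁ - (sumTo b R₂ + R₂ b)
        ≡⟨ sub-+-step (sumTo b R₁) (sumTo b R₂) (sumTo b R) (R₂ b) (R b) E
             (sumTo-sub b R₁ R₂ R E (λ s s<b → row-step n h a b c s s<b (ℕ.≤-trans (ℕ.<⇒≤ s<b) b≤h)))
             (row-last n h a b c b≤h) ⟩
      - (E * (sumTo b R + R b))               ≡⟨ cong (λ t → - (E * t)) (sym (sumTo-snoc b R)) ⟩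
      - (E * sumTo (suc b) R)                 ≡⟨ cong (λ m → - (E * sumTo (suc m) R)) (sym h⊓b≡b) ⟩
      - (E * sumTo (suc (h ⊓ b)) R)           ∎
      where
      E = stepFactor (suc n) (suc h) b c
      R₁ = λ s → row (suc n) (suc h) (suc a) b c (suc s)
      R₂ = λ s → row (suc n) (suc h) a (suc b) c (suc s)
      R = row n h a b c
      [1+h]⊓b≡b = ℕ.m≥n⇒m⊓n≡n (ℕ.m≤n⇒m≤1+n b≤h)
      h⊓b≡b = ℕ.m≥n⇒m⊓n≡n b≤h

    shifted-rows-> : ∀ n h a b c → h ℕ.< b →
      sumTo (suc h ⊓ b) (λ s → row (suc n) (suc h) (suc a) b c (suc s))
        - sumTo (suc (h ⊓ b)) (λ s → row (suc n) (suc h) a (suc b) c (suc s))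
        ≡ - (stepFactor (suc n) (suc h) b c * sumTo (suc (h ⊓ b)) (row n h a b c))
    shifted-rows-> n h a b c h<b = begin
      sumTo (suc h ⊓ b) R₁ - sumTo (suc (h ⊓ b)) R₂
        ≡⟨ cong₂ (λ m m′ → sumTo m R₁ - sumTo (suc m′) R₂) [1+h]⊓b≡1+h h⊓b≡h ⟩
      sumTo (suc h) R₁ - sumTo (suc h) R₂
        ≡⟨ sumTo-sub (suc h) R₁ R₂ R E
             (λ s s<1+h → row-step n h a b c s (ℕ.<-≤-trans s<1+h h<b) (ℕ.≤-pred s<1+h)) ⟩
      - (E * sumTo (suc h) R)                 ≡⟨ cong (λ m → - (E * sumTo (suc m) R)) (sym h⊓b≡h) ⟩
      - (E * sumTo (suc (h ⊓ b)) R)           ∎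
      where
      E = stepFactor (suc n) (suc h) b c
      R₁ = λ s → row (suc n) (suc h) (suc a) b c (suc s)
      R₂ = λ s → row (suc n) (suc h) a (suc b) c (suc s)
      R = row n h a b c
      [1+h]⊓b≡1+h = ℕ.m≤n⇒m⊓n≡m h<b
      h⊓b≡h = ℕ.m≤n⇒m⊓n≡m (ℕ.<⇒≤ h<b)

    DSum-step : ∀ n h a b c →
      DSum q (suc n) (suc h) (suc a) b c - DSum q (suc n) (suc h) a (suc b) c
        ≡ - (stepFactor (suc n) (suc h) b c * DSum q n h a b c)
    DSum-step n h a b c = begin
      DSum q (suc n) (suc h) (suc a) b c - DSum q (suc n) (suc h) a (suc b) c
        ≡⟨ cong₂ _-_ (DSum-rows (suc n) (suc h) (suc a) b c) (DSum-rows (suc n) (suc h) a (suc b) c) ⟩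
      (R₁ 0 + sumTo (suc h ⊓ b) (λ s → R₁ (suc s))) - (R₂ 0 + sumTo (suc (h ⊓ b)) (λ s → R₂ (suc s)))
        ≡⟨ cancel-first (sumTo (suc h ⊓ b) (λ s → R₁ (suc s))) (sumTo (suc (h ⊓ b)) (λ s → R₂ (suc s)))
                        (row-s₀ (suc n) (suc h) a b c) ⟩
      sumTo (suc h ⊓ b) (λ s → R₁ (suc s)) - sumTo (suc (h ⊓ b)) (λ s → R₂ (suc s))
        ≡⟨ [ shifted-rows-≤ n h a b c , shifted-rows-> n h a b c ]′ (ℕ.≤-<-connex b h) ⟩
      - (E * sumTo (suc (h ⊓ b)) (row n h a b c))
        ≡⟨ cong (λ t → - (E * t)) (sym (DSum-rows n h a b c)) ⟩
      - (E * DSum q n h a b c) ∎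
      where
      E = stepFactor (suc n) (suc h) b c
      R₁ = row (suc n) (suc h) (suc a) b c
      R₂ = row (suc n) (suc h) a (suc b) c

    DSum-step₀ : ∀ n a b c → DSum q n 0 (suc a) b c - DSum q n 0 a (suc b) c ≡ 0ℚ
    DSum-step₀ n a b c =
      trans (cong₂ _-_ (DSum-rows n 0 (suc a) b c) (DSum-rows n 0 a (suc b) c))
            (cancel-first 0ℚ 0ℚ (row-s₀ n 0 a b c))

    specialTerm : ℕ → ℕ → ℚ
    specialTerm h b = mqpow q (ℤ.- triangle h b) * inv (1ℚ - mqpow q (ℤ.- (+ h ℤ.- + b)))

    specialTerm-step : ∀ b c h →
      specialTerm (suc h) (suc b) ≡ stepFactor (suc (b ℕ.+ c)) (suc h) b c * specialTerm h b
    specialTerm-step b c h = begin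
      specialTerm (suc h) (suc b)
        ≡⟨ cong₂ (λ e d → mqpow q e * inv (1ℚ - mqpow q (ℤ.- d))) (triangle-step b c h) (difference-suc h b) ⟩
      mqpow q (e ℤ.+ ℤ.- triangle h b) * I     ≡⟨ cong (_* I) (^ℤ-+ -q≢0 e (ℤ.- triangle h b)) ⟩
      mqpow q e * mqpow q (ℤ.- triangle h b) * I ≡⟨ ℚ.*-assoc (mqpow q e) (mqpow q (ℤ.- triangle h b)) I ⟩
      stepFactor (suc (b ℕ.+ c)) (suc h) b c * specialTerm h b ∎
      where
      e = stepExponent (suc (b ℕ.+ c)) (suc h) b c
      I = inv (1ℚ - mqpow q (ℤ.- (+ h ℤ.- + b)))
      identity : ∀ h b → + 1 ℤ.+ h ℤ.- (+ 1 ℤ.+ b) ≡ h ℤ.- b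
      identity = ℤ.solve-∀
      difference-suc : ∀ h b → + suc h ℤ.- + suc b ≡ + h ℤ.- + b
      difference-suc h b rewrite +suc h | +suc b = identity (+ h) (+ b)

    D-step : ∀ a b c h →
      D q (suc (a ℕ.+ b ℕ.+ c)) h (suc a) b c - D q (suc (a ℕ.+ b ℕ.+ c)) h a (suc b) c
        ≡ - (stepFactor (suc (a ℕ.+ b ℕ.+ c)) h b c * Dprev q (suc (a ℕ.+ b ℕ.+ c)) h a b c)
    D-step zero    b c zero    = trans (DSum-step₀ n 0 b c) (sym (cong -_ (ℚ.*-zeroʳ (stepFactor n 0 b c))))
      where n = suc (b ℕ.+ c)
    D-step (suc a) b c zero    = trans (DSum-step₀ n (suc a) b c) (sym (cong -_ (ℚ.*-zeroʳ (stepFactor n 0 b c))))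
      where n = suc (suc a ℕ.+ b ℕ.+ c)
    D-step (suc a) b c (suc h) = DSum-step (suc a ℕ.+ b ℕ.+ c) h (suc a) b c
    D-step zero    b c (suc h) =
      step-with-optional-term (special h 0 b)
        (DSum q (suc (b ℕ.+ c)) (suc h) 1 b c) (DSum q (suc (b ℕ.+ c)) (suc h) 0 (suc b) c)
        (DSum q (b ℕ.+ c) h 0 b c) (specialTerm (suc h) (suc b)) (specialTerm h b)
        (stepFactor (suc (b ℕ.+ c)) (suc h) b c)
        (DSum-step (b ℕ.+ c) h 0 b c) (specialTerm-step b c h)

  1<∣-q∣ : ∀ {q} → 2 ℕ.≤ q → 1ℚ < ∣ mq q ∣
  1<∣-q∣ {q@(suc (suc _))} (ℕ.s≤s (ℕ.s≤s ℕ.z≤n))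
    rewrite ℚ.∣-p∣≡∣p∣ (qℚ q) | ℚ.normalize-coprime {q} {0} (Coprime.sym (Coprime.1-coprimeTo q)) =
      ℚ.*<* (ℤ.+<+ (ℕ.s≤s (ℕ.s≤s ℕ.z≤n)))

  oddPrimePower⇒2≤q : ∀ {q} → OddPrimePower q → 2 ℕ.≤ q
  oddPrimePower⇒2≤q (p , k , p-prime , _ , 1≤k , refl) =
    ℕ.≤-trans (ℕ.nonTrivial⇒n>1 p {{prime⇒nonTrivial p-prime}})
      (subst (ℕ._≤ p ℕ.^ k) (ℕ.*-identityʳ p) (ℕ.^-monoʳ-≤ p {{prime⇒nonZero p-prime}} 1≤k))

open import Defs
open import Data.Nat using (ℕ; suc; _+_; _∸_; _≤_)
open import Data.Integer as ℤ using (+_)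
open import Data.Rational using (_-_; _*_; -_)
open import Data.Product using (_×_)
open import Relation.Nullary using (¬_)
open import Relation.Binary.PropositionalEquality using (_≡_; refl)

theorem9p4 : (q : ℕ) → OddPrimePower q →
    (n a b c h : ℕ) → a + b + c ≡ n → h ≤ n → c ≤ n ∸ h → 1 ≤ a →
    ¬ ((a ∸ 1 ≡ 0) × (b + 1 ≡ h) × (c ≡ n ∸ h)) →
    D q n h a b c - D q n h (a ∸ 1) (suc b) c
      ≡ - (mqpow q (+ 2 ℤ.* + n ℤ.- + h ℤ.- + 1 ℤ.- + b ℤ.- + 2 ℤ.* + c)
           * Dprev q n h (a ∸ 1) b c)
theorem9p4 q q-prime-power .(suc a + b + c) (suc a) b c h refl _ _ _ _ =
  D-step q (1<∣-q∣ (oddPrimePower⇒2≤q q-prime-power)) a b c h
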